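{- The maximal functor $\mathcal M^{\circ}$, given by $\mathcal M^{\circ}(X)=(\mathcal M(X),\le_{\mathcal M(X)})$ and $\mathcal M^{\circ}(f)(S)=(f(S))^{\circ}$, is a well-defined functor from $\mathbf{Ord}$ to $\mathbf{Ord}$.
   Context: $\mathbf{Ord}$ is the category of partially ordered sets and monotone maps. For a poset $(X,\le_X)$, $\mathcal M(X)$ is the set of nonempty finite subsets of $X$ whose elements are pairwise incomparable, ordered by $S\le_{\mathcal M(X)}T$ iff for every $x_1\in S$ there is $x_2\in T$ with $x_1\le_X x_2$. For a subset $S\subseteq X$, $S^{\circ}$ denotes the set of maximal elements of $S$. -}

module Defs where

open import Level using (Level; _⊔_; suc)
open import Data.Product using (Σ; ∃; _×_; _,_; proj₁)
open import Data.List using (List)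
open import Data.List.Relation.Unary.Any using (Any)
open import Relation.Unary using (Pred; _≐_)
open import Relation.Binary.Bundles using (Poset)
open import Relation.Binary.Structures using (IsPartialOrder)
open import Relation.Binary.Morphism.Bundles using (PosetHomomorphism)
open import Function using (id; _∘_)
open import Axiom.ExcludedMiddle using (ExcludedMiddle)

-- All posets of the category Ord live at fixed universe levels c ℓ₁ ℓ₂;
-- subsets of a poset are predicates of level  c ⊔ ℓ₁ ⊔ ℓ₂ .

module _ {c ℓ₁ ℓ₂ : Level} (P : Poset c ℓ₁ ℓ₂) where
  open Poset P

  Lvl : Level
  Lvl = c ⊔ ℓ₁ ⊔ ℓ₂

  Subset : Set (c ⊔ suc Lvl)
  Subset = Pred Carrier Lvl

  RespectsEq : Subset → Set Lvl
  RespectsEq S = ∀ {x y} → x ≈ y → S x → S y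

  IsFinite : Subset → Set Lvl
  IsFinite S = ∃ λ (xs : List Carrier) →
    ∀ x → (S x → Any (x ≈_) xs) × (Any (x ≈_) xs → S x)

  IsNonempty : Subset → Set Lvl
  IsNonempty S = ∃ λ x → S x

  IsAntichain : Subset → Set Lvl
  IsAntichain S = ∀ {x y} → S x → S y → x ≤ y → x ≈ y

  record IsM (S : Subset) : Set Lvl where
    field
      respects  : RespectsEq S
      finite    : IsFinite S
      nonempty  : IsNonempty S
      antichain : IsAntichain S

  MSet : Set (c ⊔ suc Lvl)
  MSet = Σ Subset IsM

  _≤ˢ_ : Subset → Subset → Set Lvl
  S ≤ˢ T = ∀ {x} → S x → ∃ λ y → T y × x ≤ y

  _≤ᴹ_ : MSet → MSet → Set Lvl
  S ≤ᴹ T = proj₁ S ≤ˢ proj₁ T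

  _≈ᴹ_ : MSet → MSet → Set Lvl
  S ≈ᴹ T = proj₁ S ≐ proj₁ T

  maximal : Subset → Subset
  maximal S x = S x × (∀ {y} → S y → x ≤ y → x ≈ y)

image : ∀ {c ℓ₁ ℓ₂} (X Y : Poset c ℓ₁ ℓ₂) →
        (Poset.Carrier X → Poset.Carrier Y) → Subset X → Subset Y
image X Y f S y = ∃ λ x → S x × Poset._≈_ Y y (f x)

Mmap : ∀ {c ℓ₁ ℓ₂} (X Y : Poset c ℓ₁ ℓ₂) →
       (Poset.Carrier X → Poset.Carrier Y) → Subset X → Subset Y
Mmap X Y f S = maximal Y (image X Y f S)

MaximalFunctorWellDefined : (c ℓ₁ ℓ₂ : Level) → Set _
MaximalFunctorWellDefined c ℓ₁ ℓ₂ =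
  (∀ (X : Poset c ℓ₁ ℓ₂) → IsPartialOrder (_≈ᴹ_ X) (_≤ᴹ_ X))
  × (∀ (X Y : Poset c ℓ₁ ℓ₂) (f : PosetHomomorphism X Y) (S : MSet X) →
       IsM Y (Mmap X Y (PosetHomomorphism.⟦_⟧ f) (proj₁ S)))
  × (∀ (X Y : Poset c ℓ₁ ℓ₂) (f : PosetHomomorphism X Y) (S T : MSet X) →
       _≈ᴹ_ X S T →
       Mmap X Y (PosetHomomorphism.⟦_⟧ f) (proj₁ S)
         ≐ Mmap X Y (PosetHomomorphism.⟦_⟧ f) (proj₁ T))
  × (∀ (X Y : Poset c ℓ₁ ℓ₂) (f : PosetHomomorphism X Y) (S T : MSet X) →
       _≤ᴹ_ X S T →
       _≤ˢ_ Y (Mmap X Y (PosetHomomorphism.⟦_⟧ f) (proj₁ S))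
              (Mmap X Y (PosetHomomorphism.⟦_⟧ f) (proj₁ T)))
  × (∀ (X : Poset c ℓ₁ ℓ₂) (S : MSet X) → Mmap X X id (proj₁ S) ≐ proj₁ S)
  × (∀ (X Y Z : Poset c ℓ₁ ℓ₂) (f : PosetHomomorphism X Y)
       (g : PosetHomomorphism Y Z) (S : MSet X) →
       Mmap X Z (PosetHomomorphism.⟦_⟧ g ∘ PosetHomomorphism.⟦_⟧ f) (proj₁ S)
         ≐ Mmap Y Z (PosetHomomorphism.⟦_⟧ g)
             (Mmap X Y (PosetHomomorphism.⟦_⟧ f) (proj₁ S)))

-- With excluded middle, every element of a finite subset lies below one of its maximal
-- elements (found by climbing along a list enumerating the subset).  Hence f(S)° is a
-- nonempty finite antichain, and f(S) and f(S)° dominate each other in ≤ˢ, which gives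
-- monotonicity.  For composition, g(f(S)°) is a subset of g(f(S)) that dominates it, and
-- such a cofinal subset has the same maximal elements.

module Submission where

open import Defs
open import Level using (Level; _⊔_; Lift; lift; lower)
open import Axiom.ExcludedMiddle using (ExcludedMiddle)
open import Data.Product using (∃; _×_; _,_; proj₁; proj₂)
open import Data.List using (List; []; _∷_; map; filter)
open import Data.List.Relation.Unary.Any using (here; there)
import Data.List.Membership.Setoid as Membership
open import Data.List.Membership.Setoid.Properties using (∈-resp-≈; ∈-map⁺; ∈-map⁻; ∈-filter⁺; ∈-filter⁻)
open import Relation.Nullary using (Dec; yes; no; contradiction)
open import Relation.Nullary.Decidable using (map′)
open import Relation.Unary using (_⊆_; _≐_)
open import Relation.Unary.Properties using (≐-trans)
open import Relation.Unary.Relation.Binary.Equality using (≐-isEquivalence)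
open import Relation.Binary.Bundles using (Poset)
open import Relation.Binary.Structures using (IsPreorder; IsPartialOrder)
open import Relation.Binary.Morphism.Bundles using (PosetHomomorphism)
import Relation.Binary.Construct.On as On
open import Function using (id; _∘_)

module MaximalElements {c ℓ₁ ℓ₂ : Level} (P : Poset c ℓ₁ ℓ₂) where
  open Poset P
  open Membership Eq.setoid using (_∈_)

  ⊆⇒≤ˢ : {S T : Subset P} → S ⊆ T → _≤ˢ_ P S T
  ⊆⇒≤ˢ S⊆T {x} Sx = x , S⊆T Sx , refl

  ≤ˢ-trans : {S T U : Subset P} → _≤ˢ_ P S T → _≤ˢ_ P T U → _≤ˢ_ P S U
  ≤ˢ-trans S≤T T≤U Sx =
    let y , Ty , x≤y = S≤T Sx
        z , Uz , y≤z = T≤U Ty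
    in z , Uz , trans x≤y y≤z

  ≤ˢ-isPreorder : IsPreorder {A = Subset P} _≐_ (_≤ˢ_ P)
  ≤ˢ-isPreorder = record
    { isEquivalence = ≐-isEquivalence
    ; reflexive     = λ S≐T → ⊆⇒≤ˢ (proj₁ S≐T)
    ; trans         = ≤ˢ-trans
    }

  -- x ≤ y ≤ z with x, z ∈ S forces x ≈ z, hence x ≈ y.
  antichain-≤ˢ-antisym : {S T : Subset P} → IsAntichain P S → RespectsEq P T →
                         _≤ˢ_ P S T → _≤ˢ_ P T S → S ⊆ T
  antichain-≤ˢ-antisym anti respT S≤T T≤S Sx =
    let y , Ty , x≤y = S≤T Sx
        z , Sz , y≤z = T≤S Ty
        x≈z = anti Sx Sz (trans x≤y y≤z)
    in respT (Eq.sym (antisym x≤y (trans y≤z (reflexive (Eq.sym x≈z))))) Ty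

  maximal⊆ : (S : Subset P) → maximal P S ⊆ S
  maximal⊆ S = proj₁

  maximal-respects : {S : Subset P} → RespectsEq P S → RespectsEq P (maximal P S)
  maximal-respects resp x≈y (Sx , x-max) =
    resp x≈y Sx , λ Sz y≤z → Eq.trans (Eq.sym x≈y) (x-max Sz (trans (reflexive x≈y) y≤z))

  maximal-antichain : (S : Subset P) → IsAntichain P (maximal P S)
  maximal-antichain S (_ , x-max) (Sy , _) = x-max Sy

  maximal-cong : {S T : Subset P} → S ≐ T → maximal P S ≐ maximal P T
  maximal-cong (S⊆T , T⊆S) =
    (λ (Sx , x-max) → S⊆T Sx , λ Ty → x-max (T⊆S Ty)) ,
    (λ (Tx , x-max) → T⊆S Tx , λ Sy → x-max (S⊆T Sy))

  antichain⇒maximal≐ : {S : Subset P} → IsAntichain P S → maximal P S ≐ S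
  antichain⇒maximal≐ {S} anti = maximal⊆ S , λ Sx → Sx , anti Sx

  maximal-cofinal : {S T : Subset P} → T ⊆ S → _≤ˢ_ P S T → RespectsEq P T →
                    maximal P S ≐ maximal P T
  maximal-cofinal {S} {T} T⊆S S≤T respT = S°⊆T° , T°⊆S°
    where
    S°⊆T° : maximal P S ⊆ maximal P T
    S°⊆T° (Sx , x-max) =
      let y , Ty , x≤y = S≤T Sx
      in respT (Eq.sym (x-max (T⊆S Ty) x≤y)) Ty , λ Tz → x-max (T⊆S Tz)

    T°⊆S° : maximal P T ⊆ maximal P S
    T°⊆S° (Tx , x-max) = T⊆S Tx , λ {y} Sy x≤y →
      let z , Tz , y≤z = S≤T Sy
          x≈z = x-max Tz (trans x≤y y≤z)
      in antisym x≤y (trans y≤z (reflexive (Eq.sym x≈z)))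

  module Classical (em : ExcludedMiddle (c ⊔ ℓ₁ ⊔ ℓ₂)) where

    _≤?_ : ∀ x y → Dec (x ≤ y)
    x ≤? y = map′ lower lift (em {Lift (c ⊔ ℓ₁) (x ≤ y)})

    IsMaximalIn : List Carrier → Carrier → Set (c ⊔ ℓ₁ ⊔ ℓ₂)
    IsMaximalIn xs m = ∀ {z} → z ∈ xs → m ≤ z → m ≈ z

    -- If the maximal element m above t in t ∷ xs is below a, climb to a maximal element above a.
    maximal-above : ∀ t xs → ∃ λ m → m ∈ t ∷ xs × t ≤ m × IsMaximalIn (t ∷ xs) m
    maximal-above t [] = t , here Eq.refl , refl , λ { (here z≈t) _ → Eq.sym z≈t }
    maximal-above t (a ∷ xs) with maximal-above t xs
    ... | m , m∈ , t≤m , m-max with m ≤? a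
    ...   | no m≰a = m , skip m∈ , t≤m , m-max′
      where
      skip : ∀ {x} → x ∈ t ∷ xs → x ∈ t ∷ a ∷ xs
      skip (here x≈t) = here x≈t
      skip (there x∈) = there (there x∈)

      m-max′ : IsMaximalIn (t ∷ a ∷ xs) m
      m-max′ (here z≈t)          = m-max (here z≈t)
      m-max′ (there (here z≈a))  = λ m≤z → contradiction (trans m≤z (reflexive z≈a)) m≰a
      m-max′ (there (there z∈))  = m-max (there z∈)
    ...   | yes m≤a with maximal-above a xs
    ...     | n , n∈ , a≤n , n-max = n , there n∈ , trans t≤m (trans m≤a a≤n) , n-max′
      where
      n-max′ : IsMaximalIn (t ∷ a ∷ xs) n
      n-max′ (here z≈t) n≤z =
        antisym n≤z (trans (reflexive z≈t) (trans t≤m (trans m≤a a≤n)))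
      n-max′ (there z∈) = n-max z∈

    maximal-above-∈ : ∀ {t xs} → t ∈ xs → ∃ λ m → m ∈ xs × t ≤ m × IsMaximalIn xs m
    maximal-above-∈ {t} {xs} t∈xs with maximal-above t xs
    ... | m , here m≈t , t≤m , m-max = m , ∈-resp-≈ Eq.setoid (Eq.sym m≈t) t∈xs , t≤m , m-max ∘ there
    ... | m , there m∈ , t≤m , m-max = m , m∈ , t≤m , m-max ∘ there

    ≤ˢ-maximal : {S : Subset P} → IsFinite P S → _≤ˢ_ P S (maximal P S)
    ≤ˢ-maximal (xs , S≐xs) {t} St =
      let m , m∈ , t≤m , m-max = maximal-above-∈ (proj₁ (S≐xs t) St)
      in m , (proj₂ (S≐xs m) m∈ , λ {z} Sz → m-max (proj₁ (S≐xs z) Sz)) , t≤m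

    maximal-finite : {S : Subset P} → RespectsEq P S → IsFinite P S → IsFinite P (maximal P S)
    maximal-finite {S} resp (xs , S≐xs) = filter maximal? xs , λ x →
      (λ S°x → ∈-filter⁺ Eq.setoid maximal? resp° (proj₁ (S≐xs x) (proj₁ S°x)) S°x) ,
      (λ x∈ → proj₂ (∈-filter⁻ Eq.setoid maximal? resp° {xs = xs} x∈))
      where
      maximal? : ∀ x → Dec (maximal P S x)
      maximal? _ = em
      resp° : RespectsEq P (maximal P S)
      resp° = maximal-respects resp

    maximal-isM : {S : Subset P} → RespectsEq P S → IsFinite P S → IsNonempty P S →
                  IsM P (maximal P S)
    maximal-isM {S} resp fin (x , Sx) = record
      { respects  = maximal-respects resp
      ; finite    = maximal-finite resp fin
      ; nonempty  = let m , S°m , _ = ≤ˢ-maximal fin Sx in m , S°m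
      ; antichain = maximal-antichain S
      }

module _ {c ℓ₁ ℓ₂ : Level} (X Y : Poset c ℓ₁ ℓ₂) where
  private
    module X = Poset X
    module Y = Poset Y

  module _ (f : X.Carrier → Y.Carrier) where

    image-respects : (S : Subset X) → RespectsEq Y (image X Y f S)
    image-respects S y≈y′ (x , Sx , y≈fx) = x , Sx , Y.Eq.trans (Y.Eq.sym y≈y′) y≈fx

    image-⊆ : {S T : Subset X} → S ⊆ T → image X Y f S ⊆ image X Y f T
    image-⊆ S⊆T (x , Sx , y≈fx) = x , S⊆T Sx , y≈fx

    image-cong : {S T : Subset X} → S ≐ T → image X Y f S ≐ image X Y f T
    image-cong (S⊆T , T⊆S) = image-⊆ S⊆T , image-⊆ T⊆S

    image-nonempty : {S : Subset X} → IsNonempty X S → IsNonempty Y (image X Y f S)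
    image-nonempty (x , Sx) = f x , x , Sx , Y.Eq.refl

  module _ (F : PosetHomomorphism X Y) where
    open PosetHomomorphism F

    image-finite : {S : Subset X} → IsFinite X S → IsFinite Y (image X Y ⟦_⟧ S)
    image-finite (xs , S≐xs) = map ⟦_⟧ xs , λ y →
      (λ (x , Sx , y≈fx) →
        ∈-resp-≈ Y.Eq.setoid (Y.Eq.sym y≈fx) (∈-map⁺ X.Eq.setoid Y.Eq.setoid cong (proj₁ (S≐xs x) Sx))) ,
      (λ y∈ → let x , x∈ , y≈fx = ∈-map⁻ X.Eq.setoid Y.Eq.setoid y∈
              in x , proj₂ (S≐xs x) x∈ , y≈fx)

    image-mono : {S T : Subset X} → _≤ˢ_ X S T → _≤ˢ_ Y (image X Y ⟦_⟧ S) (image X Y ⟦_⟧ T)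
    image-mono S≤T (x , Sx , y≈fx) =
      let x′ , Tx′ , x≤x′ = S≤T Sx
      in ⟦ x′ ⟧ , (x′ , Tx′ , Y.Eq.refl) , Y.trans (Y.reflexive y≈fx) (mono x≤x′)

image-id : ∀ {c ℓ₁ ℓ₂} (X : Poset c ℓ₁ ℓ₂) {S : Subset X} → RespectsEq X S → image X X id S ≐ S
image-id X resp =
  (λ (x , Sx , y≈x) → resp (Poset.Eq.sym X y≈x) Sx) , (λ {x} Sx → x , Sx , Poset.Eq.refl X)

image-∘ : ∀ {c ℓ₁ ℓ₂} (X Y Z : Poset c ℓ₁ ℓ₂) (f : Poset.Carrier X → Poset.Carrier Y)
          (G : PosetHomomorphism Y Z) (S : Subset X) →
          image X Z (PosetHomomorphism.⟦_⟧ G ∘ f) S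
            ≐ image Y Z (PosetHomomorphism.⟦_⟧ G) (image X Y f S)
image-∘ X Y Z f G S =
  (λ (x , Sx , z≈gfx) → f x , (x , Sx , Poset.Eq.refl Y) , z≈gfx) ,
  (λ (y , (x , Sx , y≈fx) , z≈gy) → x , Sx , Poset.Eq.trans Z z≈gy (cong y≈fx))
  where open PosetHomomorphism G

𝓜-isPartialOrder : ∀ {c ℓ₁ ℓ₂} (X : Poset c ℓ₁ ℓ₂) → IsPartialOrder (_≈ᴹ_ X) (_≤ᴹ_ X)
𝓜-isPartialOrder X = record
  { isPreorder = On.isPreorder proj₁ ≤ˢ-isPreorder
  ; antisym    = λ {(S , S∈𝓜)} {(T , T∈𝓜)} S≤T T≤S →
      antichain-≤ˢ-antisym (IsM.antichain S∈𝓜) (IsM.respects T∈𝓜) S≤T T≤S ,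
      antichain-≤ˢ-antisym (IsM.antichain T∈𝓜) (IsM.respects S∈𝓜) T≤S S≤T
  }
  where open MaximalElements X

module _ {c ℓ₁ ℓ₂ : Level} where

  Mmap-cong : (X Y : Poset c ℓ₁ ℓ₂) (f : Poset.Carrier X → Poset.Carrier Y) {S T : Subset X} →
              S ≐ T → Mmap X Y f S ≐ Mmap X Y f T
  Mmap-cong X Y f S≐T = MaximalElements.maximal-cong Y (image-cong X Y f S≐T)

  Mmap-id : (X : Poset c ℓ₁ ℓ₂) {S : Subset X} → RespectsEq X S → IsAntichain X S →
            Mmap X X id S ≐ S
  Mmap-id X resp anti = ≐-trans (maximal-cong (image-id X resp)) (antichain⇒maximal≐ anti)
    where open MaximalElements X

  module _ (em : ExcludedMiddle (c ⊔ ℓ₁ ⊔ ℓ₂)) {X Y : Poset c ℓ₁ ℓ₂} (F : PosetHomomorphism X Y) where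
    open PosetHomomorphism F using (⟦_⟧)
    open MaximalElements Y
    open Classical em

    Mmap-isM : {S : Subset X} → IsFinite X S → IsNonempty X S → IsM Y (Mmap X Y ⟦_⟧ S)
    Mmap-isM {S} fin nonempty =
      maximal-isM (image-respects X Y ⟦_⟧ S) (image-finite X Y F fin)
                  (image-nonempty X Y ⟦_⟧ nonempty)

    Mmap-mono : {S T : Subset X} → IsFinite X T → _≤ˢ_ X S T →
                _≤ˢ_ Y (Mmap X Y ⟦_⟧ S) (Mmap X Y ⟦_⟧ T)
    Mmap-mono {S} finT S≤T =
      ≤ˢ-trans (⊆⇒≤ˢ (maximal⊆ (image X Y ⟦_⟧ S)))
               (≤ˢ-trans (image-mono X Y F S≤T) (≤ˢ-maximal (image-finite X Y F finT)))

    Mmap-∘ : {Z : Poset c ℓ₁ ℓ₂} (G : PosetHomomorphism Y Z) {S : Subset X} → IsFinite X S →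
             Mmap X Z (PosetHomomorphism.⟦_⟧ G ∘ ⟦_⟧) S
               ≐ Mmap Y Z (PosetHomomorphism.⟦_⟧ G) (Mmap X Y ⟦_⟧ S)
    Mmap-∘ {Z} G {S} fin =
      ≐-trans (MaximalElements.maximal-cong Z (image-∘ X Y Z ⟦_⟧ G S))
              (MaximalElements.maximal-cofinal Z
                 (image-⊆ Y Z g (maximal⊆ (image X Y ⟦_⟧ S)))
                 (image-mono Y Z G (≤ˢ-maximal (image-finite X Y F fin)))
                 (image-respects Y Z g (maximal Y (image X Y ⟦_⟧ S))))
      where open PosetHomomorphism G renaming (⟦_⟧ to g)

propositionD10 : ∀ {c ℓ₁ ℓ₂ : Level} → ExcludedMiddle (c ⊔ ℓ₁ ⊔ ℓ₂) →
    MaximalFunctorWellDefined c ℓ₁ ℓ₂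
propositionD10 em =
    𝓜-isPartialOrder
  , (λ X Y F (S , S∈𝓜) → Mmap-isM em F (IsM.finite S∈𝓜) (IsM.nonempty S∈𝓜))
  , (λ X Y F S T S≐T → Mmap-cong X Y (PosetHomomorphism.⟦_⟧ F) S≐T)
  , (λ X Y F S (T , T∈𝓜) S≤T → Mmap-mono em F (IsM.finite T∈𝓜) S≤T)
  , (λ X (S , S∈𝓜) → Mmap-id X (IsM.respects S∈𝓜) (IsM.antichain S∈𝓜))
  , (λ X Y Z F G (S , S∈𝓜) → Mmap-∘ em F G (IsM.finite S∈𝓜))
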